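{- Let $T$ be a set of rooted binary phylogenetic trees on the same leaf set $X$, let $s$ be a cherry picking sequence for $T$, let $x$ be a leaf with $w_T(x)>0$, and let $a,b\in N_T(x)$ with $a\neq b$. Then $s$ satisfies one of the following constraint sets: $\{(a,x)\}$, $\{(b,x)\}$, $\{(x,a),(x,b)\}$.
   Context: A tree is a rooted binary phylogenetic $X$-tree (every non-leaf vertex has out-degree 2, leaves bijectively labelled by $X$). $\mathcal{T}\setminus A$ is obtained by deleting the leaves in $A$ and repeatedly suppressing vertices with in- and out-degree one; $T\setminus A=\{\mathcal{T}\setminus A:\mathcal{T}\in T\}$. A cherry is a pair of leaves with a common parent; $(a,b)\in\mathcal{T}$ (equivalently $(b,a)\in\mathcal{T}$) means $\{a,b\}$ is a cherry of $\mathcal{T}$, and $(a,b)\in T$ means it is a cherry of some tree of $T$. $H(T)$ is the set of leaves in a cherry in every tree of $T$. $N_T(x)=\{y:(y,x)\in\mathcal{T}\text{ for some }\mathcal{T}\in T\}$, $w_T(x)=|N_T(x)|-1$. A cherry picking sequence for $T$ is a sequence $(s_1,\dots,s_n)$ containing each leaf exactly once with $s_i\in H(T\setminus\{s_1,\dots,s_{i-1}\})$ for $i\le n-1$. A sequence $s$ satisfies a set $C$ of ordered pairs of leaves if for every $(p,q)\in C$ there is an index $i$ with $s_i=p$, $(p,q)\in T'$ and $w_{T'}(p)>0$, where $T'=T\setminus\{s_1,\dots,s_{i-1}\}$. -}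

module Defs where

open import Data.Nat using (ℕ; suc; _≡ᵇ_; _<_; _∸_; _≟_)
open import Data.Bool using (Bool; true; false; if_then_else_)
open import Data.List using (List; []; _∷_; [_]; _++_; concatMap; length; take; mapMaybe; deduplicate; lookup)
open import Data.Bool.ListAction using (any)
open import Data.Maybe using (Maybe; just; nothing)
open import Data.Product using (_×_; _,_; ∃; proj₁; proj₂)
open import Data.Sum using (_⊎_)
open import Data.Fin using (Fin; toℕ)
open import Relation.Binary.PropositionalEquality using (_≡_)
open import Data.List.Membership.Propositional using (_∈_)
open import Data.List.Relation.Unary.All using (All)
open import Data.List.Relation.Unary.Any using (Any)
open import Data.List.Relation.Unary.Unique.Propositional using (Unique)
open import Data.List.Relation.Binary.Permutation.Propositional using (_↭_)

data Tree : Set where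
  leaf : ℕ → Tree
  node : Tree → Tree → Tree

leaves : Tree → List ℕ
leaves (leaf x) = x ∷ []
leaves (node l r) = leaves l ++ leaves r

-- A rooted binary phylogenetic X-tree: leaf labels are exactly X, each once
-- (X itself is a duplicate-free list, see the theorem).
IsPhyloTree : List ℕ → Tree → Set
IsPhyloTree X t = leaves t ↭ X

cherries : Tree → List (ℕ × ℕ)
cherries (leaf _) = []
cherries (node (leaf a) (leaf b)) = (a , b) ∷ []
cherries (node (leaf a) (node l r)) = cherries (node l r)
cherries (node (node l r) (leaf b)) = cherries (node l r)
cherries (node (node l r) (node l' r')) = cherries (node l r) ++ cherries (node l' r')

CherryOf : ℕ → ℕ → Tree → Set
CherryOf a b t = (a , b) ∈ cherries t ⊎ (b , a) ∈ cherries t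

CherryIn : ℕ → ℕ → List Tree → Set
CherryIn a b T = Any (CherryOf a b) T

_∈ᵇ_ : ℕ → List ℕ → Bool
x ∈ᵇ A = any (λ y → x ≡ᵇ y) A

-- 𝒯 \ A : delete leaves in A and suppress resulting vertices of out-degree one
-- (nothing if every leaf is deleted).
deleteLeaves : List ℕ → Tree → Maybe Tree
deleteLeaves A (leaf x) = if x ∈ᵇ A then nothing else just (leaf x)
deleteLeaves A (node l r) with deleteLeaves A l | deleteLeaves A r
... | nothing | nothing = nothing
... | nothing | just r' = just r'
... | just l' | nothing = just l'
... | just l' | just r' = just (node l' r')

_∖_ : List Tree → List ℕ → List Tree
T ∖ A = mapMaybe (deleteLeaves A) T

InH : ℕ → List Tree → Set
InH x T = All (λ t → ∃ λ y → CherryOf x y t) T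

partnersIn : ℕ → Tree → List ℕ
partnersIn x t = concatMap (λ c → if proj₁ c ≡ᵇ x then [ proj₂ c ]
                                  else (if proj₂ c ≡ᵇ x then [ proj₁ c ] else []))
                           (cherries t)

N : List Tree → ℕ → List ℕ
N T x = deduplicate _≟_ (concatMap (partnersIn x) T)

w : List Tree → ℕ → ℕ
w T x = length (N T x) ∸ 1

-- cherry picking sequence for T (on leaf set X); indices are 0-based,
-- so the condition "i ≤ n-1" becomes suc i < n.
IsCPS : List ℕ → List Tree → List ℕ → Set
IsCPS X T s = (s ↭ X) ×
  ((i : Fin (length s)) → suc (toℕ i) < length s → InH (lookup s i) (T ∖ take (toℕ i) s))

Satisfies : List Tree → List ℕ → List (ℕ × ℕ) → Set
Satisfies T s C = All (λ c → ∃ λ (i : Fin (length s)) →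
    (lookup s i ≡ proj₁ c) ×
    CherryIn (proj₁ c) (proj₂ c) (T ∖ take (toℕ i) s) ×
    (0 < w (T ∖ take (toℕ i) s) (proj₁ c))) C

module Submission where

-- Proof idea: look at the FIRST position i of the cherry picking sequence s that
-- holds one of x, a, b.  Choose trees of T with cherries {a,x} and {b,x}.  The
-- prefix s₁ … sᵢ₋₁ contains none of x, a, b, so both cherries survive in
-- T' = T ∖ {s₁,…,sᵢ₋₁}.
--   * sᵢ = x : a ≠ b are both neighbours of x in T', so w_T'(x) > 0 and s
--     satisfies {(x,a),(x,b)} at position i.
--   * sᵢ = a : x is picked later, so i is not the last position and a ∈ H(T').
--     In the surviving tree with cherry {b,x}, a has a sibling y, and y ≠ x since
--     x already has the sibling b ≠ a.  Thus x, y are distinct neighbours of a,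
--     and s satisfies {(a,x)} at position i.  The case sᵢ = b is symmetric.

open import Defs
open import Data.Nat using (ℕ; suc; _<_; _∸_; _≡ᵇ_; _≟_; z≤n; s≤s)
open import Data.Nat.Properties using (≡ᵇ⇒≡; ≡⇒≡ᵇ)
open import Data.Bool using (true; false; if_then_else_)
open import Data.Bool.Properties using (T-≡)
open import Data.List using (List; []; _∷_; [_]; _++_; length; lookup; take; mapMaybe)
open import Data.Maybe using (Maybe; just; nothing)
import Data.Maybe.Relation.Unary.Any as MaybeAny
open import Data.Product using (_×_; _,_; ∃; proj₁; proj₂)
open import Data.Sum using (_⊎_; inj₁; inj₂)
open import Data.Fin using (Fin; toℕ)
open import Function.Bundles using (Equivalence)
open import Level using (0ℓ)
open import Relation.Nullary using (yes; no; contradiction)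
open import Relation.Unary using (Pred; Decidable; ∁)
open import Relation.Binary.PropositionalEquality
  using (_≡_; _≢_; refl; sym; cong; subst; setoid)
open import Data.List.Membership.Propositional using (_∈_; _∉_; find; lose)
open import Data.List.Membership.Propositional.Properties using (∈-++⁻; ∈-++⁺ˡ; ∈-++⁺ʳ; ∈-deduplicate⁻; ∈-deduplicate⁺)
open import Data.List.Membership.DecPropositional _≟_ using (_∈?_)
open import Data.List.Relation.Unary.All using (All; []; _∷_)
import Data.List.Relation.Unary.All as All
import Data.List.Relation.Unary.All.Properties as All
open import Data.List.Relation.Unary.Any using (Any; here; there)
import Data.List.Relation.Unary.Any.Properties as Any
open import Data.List.Relation.Unary.AllPairs using ([]; _∷_)
open import Data.List.Relation.Unary.First using (First; _∷_; index; index-satisfied)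
import Data.List.Relation.Unary.First as First
open import Data.List.Relation.Unary.Unique.Propositional using (Unique)
open import Data.List.Relation.Binary.Disjoint.Propositional using (Disjoint)
open import Data.List.Relation.Binary.Sublist.Propositional using (_⊆_; []; _∷_; _∷ʳ_; ⊆-refl)
open import Data.List.Relation.Binary.Sublist.Propositional.Properties using (++⁺; ++⁺ˡ; ++⁺ʳ; All-resp-⊆)
open import Data.List.Relation.Binary.Permutation.Propositional using (_↭_; ↭-sym; ↭⇒↭ₛ)
open import Data.List.Relation.Binary.Permutation.Propositional.Properties using (∈-resp-↭)
import Data.List.Relation.Binary.Permutation.Setoid.Properties as PermutationSetoid

unique-resp-↭ : {xs ys : List ℕ} → xs ↭ ys → Unique xs → Unique ys
unique-resp-↭ p = PermutationSetoid.Unique-resp-↭ (setoid ℕ) (↭⇒↭ₛ p)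

unique-⊆ : {xs ys : List ℕ} → xs ⊆ ys → Unique ys → Unique xs
unique-⊆ []         u         = u
unique-⊆ (_ ∷ʳ τ)   (_ ∷ u)   = unique-⊆ τ u
unique-⊆ (refl ∷ τ) (y∉ ∷ u)  = All-resp-⊆ τ y∉ ∷ unique-⊆ τ u

unique-++ : (xs : List ℕ) {ys : List ℕ} → Unique (xs ++ ys) →
            Unique xs × Unique ys × Disjoint xs ys
unique-++ []       u         = [] , u , λ { (() , _) }
unique-++ (x ∷ xs) (x∉ ∷ u) with unique-++ xs u
... | uxs , uys , disjoint = All.++⁻ˡ xs x∉ ∷ uxs , uys , λ
  { (here refl , v∈ys) → All.lookup (All.++⁻ʳ xs x∉) v∈ys refl
  ; (there v∈xs , v∈ys) → disjoint (v∈xs , v∈ys) }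

cherry-split : ∀ {p q} l r → (p , q) ∈ cherries (node l r) →
  (p , q) ∈ cherries l ⊎ (p , q) ∈ cherries r ⊎ (l ≡ leaf p × r ≡ leaf q)
cherry-split (leaf _)   (leaf _)   (here refl) = inj₂ (inj₂ (refl , refl))
cherry-split (leaf _)   (node _ _) m = inj₂ (inj₁ m)
cherry-split (node _ _) (leaf _)   m = inj₁ m
cherry-split (node l r) (node _ _) m with ∈-++⁻ (cherries (node l r)) m
... | inj₁ m' = inj₁ m'
... | inj₂ m' = inj₂ (inj₁ m')

cherry-inˡ : ∀ {c} l r → c ∈ cherries l → c ∈ cherries (node l r)
cherry-inˡ (node _ _) (leaf _)   m = m
cherry-inˡ (node _ _) (node _ _) m = ∈-++⁺ˡ m

cherry-inʳ : ∀ {c} l r → c ∈ cherries r → c ∈ cherries (node l r)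
cherry-inʳ (leaf _)   (node _ _) m = m
cherry-inʳ (node l r) (node _ _) m = ∈-++⁺ʳ (cherries (node l r)) m

cherry-leaves : ∀ {p q z} t → (p , q) ∈ cherries t → z ∈ p ∷ q ∷ [] → z ∈ leaves t
cherry-leaves (node l r) m z∈ with cherry-split l r m
... | inj₁ m'               = ∈-++⁺ˡ (cherry-leaves l m' z∈)
... | inj₂ (inj₁ m')        = ∈-++⁺ʳ (leaves l) (cherry-leaves r m' z∈)
... | inj₂ (inj₂ (refl , refl)) = z∈

cherry-distinct : ∀ {p q} t → Unique (leaves t) → (p , q) ∈ cherries t → p ≢ q
cherry-distinct (node l r) u m with unique-++ (leaves l) u | cherry-split l r m
... | ul , _  , _ | inj₁ m'        = cherry-distinct l ul m'
... | _  , ur , _ | inj₂ (inj₁ m') = cherry-distinct r ur m'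
cherry-distinct (node _ _) ((p≢q ∷ []) ∷ _) _ | _ | inj₂ (inj₂ (refl , refl)) = p≢q

cherries-overlap : ∀ {p q p' q' z} t → Unique (leaves t) →
  (p , q) ∈ cherries t → (p' , q') ∈ cherries t →
  z ∈ p ∷ q ∷ [] → z ∈ p' ∷ q' ∷ [] → (p , q) ≡ (p' , q')
cherries-overlap (node l r) u m m' z∈ z∈' with unique-++ (leaves l) u | cherry-split l r m | cherry-split l r m'
... | ul , _ , _ | inj₁ n | inj₁ n' = cherries-overlap l ul n n' z∈ z∈'
... | _ , ur , _ | inj₂ (inj₁ n) | inj₂ (inj₁ n') = cherries-overlap r ur n n' z∈ z∈'
... | _ , _ , disjoint | inj₁ n | inj₂ (inj₁ n') =
  contradiction (cherry-leaves l n z∈ , cherry-leaves r n' z∈') disjoint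
... | _ , _ , disjoint | inj₂ (inj₁ n) | inj₁ n' =
  contradiction (cherry-leaves l n' z∈' , cherry-leaves r n z∈) disjoint
... | _ | inj₂ (inj₂ (refl , refl)) | inj₂ (inj₂ (refl , refl)) = refl
... | _ | inj₂ (inj₂ (refl , refl)) | inj₁ ()
... | _ | inj₂ (inj₂ (refl , refl)) | inj₂ (inj₁ ())
... | _ | inj₁ () | inj₂ (inj₂ (refl , refl))
... | _ | inj₂ (inj₁ ()) | inj₂ (inj₂ (refl , refl))

cherryOf-distinct : ∀ {p q} t → Unique (leaves t) → CherryOf p q t → p ≢ q
cherryOf-distinct t u (inj₁ m) = cherry-distinct t u m
cherryOf-distinct t u (inj₂ m) p≡q = cherry-distinct t u m (sym p≡q)

sibling-unique : ∀ {a b x} t → Unique (leaves t) → CherryOf a x t → CherryOf b x t → a ≡ b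
sibling-unique t u (inj₁ m) (inj₁ m') =
  cong proj₁ (cherries-overlap t u m m' (there (here refl)) (there (here refl)))
sibling-unique t u (inj₂ m) (inj₂ m') =
  cong proj₂ (cherries-overlap t u m m' (here refl) (here refl))
sibling-unique t u (inj₁ m) (inj₂ m') =
  contradiction (cong proj₁ (cherries-overlap t u m m' (there (here refl)) (here refl)))
                (cherry-distinct t u m)
sibling-unique t u (inj₂ m) (inj₁ m') =
  contradiction (sym (cong proj₂ (cherries-overlap t u m m' (here refl) (there (here refl)))))
                (cherry-distinct t u m)

cherryOf-sym : ∀ {p q} t → CherryOf p q t → CherryOf q p t
cherryOf-sym _ (inj₁ m) = inj₂ m
cherryOf-sym _ (inj₂ m) = inj₁ m

cherryOf-leafʳ : ∀ {p q} t → CherryOf p q t → q ∈ leaves t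
cherryOf-leafʳ t (inj₁ m) = cherry-leaves t m (there (here refl))
cherryOf-leafʳ t (inj₂ m) = cherry-leaves t m (here refl)

≡ᵇ-true⇒≡ : ∀ {m n} → (m ≡ᵇ n) ≡ true → m ≡ n
≡ᵇ-true⇒≡ {m} {n} e = ≡ᵇ⇒≡ m n (Equivalence.from T-≡ e)

≡ᵇ-refl : ∀ n → (n ≡ᵇ n) ≡ true
≡ᵇ-refl n = Equivalence.to T-≡ (≡⇒≡ᵇ n n refl)

∉⇒∈ᵇ-false : ∀ {z} A → z ∉ A → z ∈ᵇ A ≡ false
∉⇒∈ᵇ-false []      _  = refl
∉⇒∈ᵇ-false {z} (y ∷ A) z∉ with z ≡ᵇ y in z≡y
... | true  = contradiction (here (≡ᵇ-true⇒≡ z≡y)) z∉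
... | false = ∉⇒∈ᵇ-false A (λ z∈ → z∉ (there z∈))

deletion-keeps-cherry : ∀ A {p q} t → (p , q) ∈ cherries t → p ∈ᵇ A ≡ false → q ∈ᵇ A ≡ false →
  ∃ λ t' → deleteLeaves A t ≡ just t' × (p , q) ∈ cherries t'
deletion-keeps-cherry A (node l r) m p∉ q∉ with cherry-split l r m
... | inj₁ m' with deletion-keeps-cherry A l m' p∉ q∉
...   | l' , del-l , m-l rewrite del-l with deleteLeaves A r
...     | nothing = l' , refl , m-l
...     | just r' = node l' r' , refl , cherry-inˡ l' r' m-l
deletion-keeps-cherry A (node l r) m p∉ q∉ | inj₂ (inj₁ m') with deletion-keeps-cherry A r m' p∉ q∉
...   | r' , del-r , m-r rewrite del-r with deleteLeaves A l
...     | nothing = r' , refl , m-r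
...     | just l' = node l' r' , refl , cherry-inʳ l' r' m-r
deletion-keeps-cherry A (node _ _) _ p∉ q∉ | inj₂ (inj₂ (refl , refl)) rewrite p∉ | q∉ =
  _ , refl , here refl

deletion-keeps-cherryOf : ∀ A {p q} t → CherryOf p q t → p ∈ᵇ A ≡ false → q ∈ᵇ A ≡ false →
  ∃ λ t' → deleteLeaves A t ≡ just t' × CherryOf p q t'
deletion-keeps-cherryOf A t (inj₁ m) p∉ q∉ with deletion-keeps-cherry A t m p∉ q∉
... | t' , del , m' = t' , del , inj₁ m'
deletion-keeps-cherryOf A t (inj₂ m) p∉ q∉ with deletion-keeps-cherry A t m q∉ p∉
... | t' , del , m' = t' , del , inj₂ m'

deletion-leaves-⊆ : ∀ A t {t'} → deleteLeaves A t ≡ just t' → leaves t' ⊆ leaves t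
deletion-leaves-⊆ A (leaf x) del with x ∈ᵇ A
deletion-leaves-⊆ A (leaf x) refl | false = ⊆-refl
deletion-leaves-⊆ A (node l r) del with deleteLeaves A l in del-l | deleteLeaves A r in del-r
deletion-leaves-⊆ A (node l r) refl | nothing | just _ =
  ++⁺ˡ (leaves l) (deletion-leaves-⊆ A r del-r)
deletion-leaves-⊆ A (node l r) refl | just _  | nothing =
  ++⁺ʳ (leaves r) (deletion-leaves-⊆ A l del-l)
deletion-leaves-⊆ A (node l r) refl | just _  | just _ =
  ++⁺ (deletion-leaves-⊆ A l del-l) (deletion-leaves-⊆ A r del-r)

∈-mapMaybe⁺ : ∀ {A B : Set} {f : A → Maybe B} {x y} (xs : List A) →
              x ∈ xs → f x ≡ just y → y ∈ mapMaybe f xs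
∈-mapMaybe⁺ {f = f} {y = y} xs x∈ fx≡y =
  Any.mapMaybe⁺ f xs (Any.map⁺ (lose x∈ (subst (MaybeAny.Any (y ≡_)) (sym fx≡y) (MaybeAny.just refl))))

record CherryWitness (T : List Tree) (p q : ℕ) : Set where
  constructor witness
  field
    tree     : Tree
    member   : tree ∈ T
    distinct : Unique (leaves tree)
    cherry   : CherryOf p q tree
open CherryWitness

witness-distinct : ∀ {T p q} → CherryWitness T p q → p ≢ q
witness-distinct wit = cherryOf-distinct (tree wit) (distinct wit) (cherry wit)

witness-sym : ∀ {T p q} → CherryWitness T p q → CherryWitness T q p
witness-sym (witness t t∈T u c) = witness t t∈T u (cherryOf-sym t c)

witness⇒CherryIn : ∀ {T p q} → CherryWitness T p q → CherryIn p q T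
witness⇒CherryIn wit = lose (member wit) (cherry wit)

witness-survives : ∀ {T p q} A → p ∉ A → q ∉ A → CherryWitness T p q → CherryWitness (T ∖ A) p q
witness-survives {T} A p∉ q∉ (witness t t∈T u c)
  with deletion-keeps-cherryOf A t c (∉⇒∈ᵇ-false A p∉) (∉⇒∈ᵇ-false A q∉)
... | t' , del , c' =
  witness t' (∈-mapMaybe⁺ T t∈T del) (unique-⊆ (deletion-leaves-⊆ A t del) u) c'

partnersOfCherry : ℕ → ℕ × ℕ → List ℕ
partnersOfCherry x (p , q) = if p ≡ᵇ x then [ q ] else (if q ≡ᵇ x then [ p ] else [])

partner⁻ : ∀ {x z} c → z ∈ partnersOfCherry x c → c ≡ (z , x) ⊎ c ≡ (x , z)
partner⁻ {x} (p , q) z∈ with p ≡ᵇ x in p≡x | q ≡ᵇ x in q≡x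
partner⁻ (p , q) (here refl) | true  | _    = inj₂ (cong (_, q) (≡ᵇ-true⇒≡ p≡x))
partner⁻ (p , q) (here refl) | false | true = inj₁ (cong (p ,_) (≡ᵇ-true⇒≡ q≡x))

partner⁺ : ∀ {x z} c → c ≡ (z , x) ⊎ c ≡ (x , z) → z ∈ partnersOfCherry x c
partner⁺ {x} {z} _ (inj₁ refl) with z ≡ᵇ x in z≡x
... | true  = here (≡ᵇ-true⇒≡ z≡x)
... | false rewrite ≡ᵇ-refl x = here refl
partner⁺ {x} _ (inj₂ refl) rewrite ≡ᵇ-refl x = here refl

partnersIn⁻ : ∀ {x z} t → z ∈ partnersIn x t → CherryOf z x t
partnersIn⁻ {x} t z∈ with find (Any.concatMap⁻ (partnersOfCherry x) z∈)
... | c , c∈ , z∈c with partner⁻ c z∈c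
...   | inj₁ refl = inj₁ c∈
...   | inj₂ refl = inj₂ c∈

partnersIn⁺ : ∀ {x z} t → CherryOf z x t → z ∈ partnersIn x t
partnersIn⁺ {x} t (inj₁ m) = Any.concatMap⁺ (partnersOfCherry x) (lose m (partner⁺ {x} _ (inj₁ refl)))
partnersIn⁺ {x} t (inj₂ m) = Any.concatMap⁺ (partnersOfCherry x) (lose m (partner⁺ {x} _ (inj₂ refl)))

N⁻ : ∀ {T x z} → z ∈ N T x → ∃ λ t → t ∈ T × CherryOf z x t
N⁻ {x = x} z∈ with find (Any.concatMap⁻ (partnersIn x) (∈-deduplicate⁻ _≟_ _ z∈))
... | t , t∈T , z∈t = t , t∈T , partnersIn⁻ t z∈t

N⁺ : ∀ {T x z t} → t ∈ T → CherryOf z x t → z ∈ N T x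
N⁺ {x = x} {t = t} t∈T c = ∈-deduplicate⁺ _≟_ (Any.concatMap⁺ (partnersIn x) (lose t∈T (partnersIn⁺ t c)))

N⇒witness : ∀ {T x z} → All (λ t → Unique (leaves t)) T → z ∈ N T x → CherryWitness T z x
N⇒witness distinctLeaves z∈ with N⁻ z∈
... | t , t∈T , c = witness t t∈T (All.lookup distinctLeaves t∈T) c

two-members : ∀ {a b : ℕ} xs → a ∈ xs → b ∈ xs → a ≢ b → 0 < length xs ∸ 1
two-members (_ ∷ [])    (here refl) (here refl) a≢b = contradiction refl a≢b
two-members (_ ∷ _ ∷ _) _           _           _   = s≤s z≤n

weight-of-shared : ∀ {T a b x} → a ≢ b → CherryWitness T a x → CherryWitness T b x → 0 < w T x
weight-of-shared {T} {x = x} a≢b wa wb =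
  two-members (N T x) (N⁺ (member wa) (cherry wa)) (N⁺ (member wb) (cherry wb)) a≢b

-- If moreover a ∈ H(T), then w_T(a) > 0: in the tree with cherry {b,x}, a has a
-- sibling y, and y ≠ x because x's only sibling there is b ≠ a.
weight-of-picked : ∀ {T a b x} → a ≢ b → CherryWitness T a x → CherryWitness T b x →
                   InH a T → 0 < w T a
weight-of-picked {T} {a} {x = x} a≢b wa (witness tb tb∈T u bx) a∈H with All.lookup a∈H tb∈T
... | y , ay = two-members (N T a) (N⁺ (member wa) (cherryOf-sym (tree wa) (cherry wa)))
                                   (N⁺ tb∈T (cherryOf-sym tb ay)) x≢y
  where
  x≢y : x ≢ y
  x≢y refl = a≢b (sibling-unique tb u ay bx)

first-occurrence : ∀ {A : Set} {Q : Pred A 0ℓ} {xs} → Decidable Q → Any Q xs → First (∁ Q) Q xs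
first-occurrence {xs = y ∷ _} Q? q with Q? y
... | yes qy = First.[ qy ]
first-occurrence Q? (here qy) | no ¬qy = contradiction qy ¬qy
first-occurrence Q? (there q) | no ¬qy = ¬qy ∷ first-occurrence Q? q

before-first : ∀ {A : Set} {P Q : Pred A 0ℓ} {xs} (f : First P Q xs) → All P (take (toℕ (index f)) xs)
before-first First.[ _ ] = []
before-first (px ∷ f)    = px ∷ before-first f

first-not-last : ∀ {A : Set} {Q : Pred A 0ℓ} {xs z} (f : First (∁ Q) Q xs) →
                 z ∈ xs → Q z → z ≢ lookup xs (index f) → suc (toℕ (index f)) < length xs
first-not-last First.[ _ ] (here refl)         _  z≢first = contradiction refl z≢first
first-not-last First.[ _ ] (there (here _))    _  _       = s≤s (s≤s z≤n)
first-not-last First.[ _ ] (there (there _))   _  _       = s≤s (s≤s z≤n)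
first-not-last (¬qy ∷ f)   (here refl)         qz _       = contradiction qz ¬qy
first-not-last (¬qy ∷ f)   (there z∈)          qz z≢first = s≤s (first-not-last f z∈ qz z≢first)

OneOfConstraintSets : List Tree → List ℕ → ℕ → ℕ → ℕ → Set
OneOfConstraintSets T s x a b =
  Satisfies T s ((a , x) ∷ []) ⊎ Satisfies T s ((b , x) ∷ []) ⊎ Satisfies T s ((x , a) ∷ (x , b) ∷ [])

picked-in-H : ∀ {x z} T s (i : Fin (length s)) →
  (lookup s i ≢ x → InH (lookup s i) (T ∖ take (toℕ i) s)) →
  CherryWitness (T ∖ take (toℕ i) s) z x → lookup s i ≡ z → InH z (T ∖ take (toℕ i) s)
picked-in-H _ _ i inH wz refl = inH (witness-distinct wz)

satisfied-at : ∀ {x a b} T s (i : Fin (length s)) → a ≢ b →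
  CherryWitness (T ∖ take (toℕ i) s) a x → CherryWitness (T ∖ take (toℕ i) s) b x →
  (lookup s i ≢ x → InH (lookup s i) (T ∖ take (toℕ i) s)) →
  lookup s i ∈ x ∷ a ∷ b ∷ [] → OneOfConstraintSets T s x a b
satisfied-at T s i a≢b wa wb inH (here sᵢ≡x) =
  inj₂ (inj₂ ( (i , sᵢ≡x , witness⇒CherryIn (witness-sym wa) , weight-of-shared a≢b wa wb)
             ∷ (i , sᵢ≡x , witness⇒CherryIn (witness-sym wb) , weight-of-shared a≢b wa wb) ∷ []))
satisfied-at T s i a≢b wa wb inH (there (here sᵢ≡a)) =
  inj₁ ((i , sᵢ≡a , witness⇒CherryIn wa , weight-of-picked a≢b wa wb (picked-in-H T s i inH wa sᵢ≡a)) ∷ [])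
satisfied-at T s i a≢b wa wb inH (there (there (here sᵢ≡b))) =
  inj₂ (inj₁ ((i , sᵢ≡b , witness⇒CherryIn wb
              , weight-of-picked (λ b≡a → a≢b (sym b≡a)) wb wa (picked-in-H T s i inH wb sᵢ≡b)) ∷ []))

mainTheorem3 : (X : List ℕ) (T : List Tree) (s : List ℕ) (x a b : ℕ)
    → Unique X → All (IsPhyloTree X) T
    → IsCPS X T s → 0 < w T x
    → a ∈ N T x → b ∈ N T x → a ≢ b
    → Satisfies T s ((a , x) ∷ []) ⊎ Satisfies T s ((b , x) ∷ [])
      ⊎ Satisfies T s ((x , a) ∷ (x , b) ∷ [])
mainTheorem3 X T s x a b uniqueX phylo (s↭X , picks) _ a∈N b∈N a≢b =
  satisfied-at T s i a≢b (survives (there (here refl)) wa) (survives (there (there (here refl))) wb)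
               inH (index-satisfied first)
  where
  distinctLeaves : All (λ t → Unique (leaves t)) T
  distinctLeaves = All.map (λ t↭X → unique-resp-↭ (↭-sym t↭X) uniqueX) phylo
  wa : CherryWitness T a x
  wa = N⇒witness distinctLeaves a∈N
  wb : CherryWitness T b x
  wb = N⇒witness distinctLeaves b∈N
  x∈s : x ∈ s
  x∈s = ∈-resp-↭ (↭-sym s↭X) (∈-resp-↭ (All.lookup phylo (member wa)) (cherryOf-leafʳ (tree wa) (cherry wa)))
  first : First (∁ (_∈ x ∷ a ∷ b ∷ [])) (_∈ x ∷ a ∷ b ∷ []) s
  first = first-occurrence (_∈? x ∷ a ∷ b ∷ []) (lose x∈s (here refl))
  i : Fin (length s)
  i = index first
  -- the prefix before i deletes none of x, a, b, so their cherries survive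
  survives : ∀ {z} → z ∈ x ∷ a ∷ b ∷ [] → CherryWitness T z x → CherryWitness (T ∖ take (toℕ i) s) z x
  survives z∈xab = witness-survives (take (toℕ i) s) (unpicked z∈xab) (unpicked (here refl))
    where
    unpicked : ∀ {y} → y ∈ x ∷ a ∷ b ∷ [] → y ∉ take (toℕ i) s
    unpicked y∈xab y∈prefix = All.lookup (before-first first) y∈prefix y∈xab
  -- if sᵢ ≠ x, then x is picked later, so i is not the last position
  inH : lookup s i ≢ x → InH (lookup s i) (T ∖ take (toℕ i) s)
  inH sᵢ≢x = picks i (first-not-last first x∈s (here refl) (λ x≡sᵢ → sᵢ≢x (sym x≡sᵢ)))
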